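{- Let $\Gamma$ be a proper LDDG with parameters $(v,k,\lambda_1,\lambda_2,m,n)$. Then $\lambda_2 \leq \lfloor k^2/v \rfloor$.
   Context: Graphs here are finite, undirected, without multiple edges, but loops are allowed: a vertex may be adjacent to itself. For a vertex $x$, $\Gamma(x)$ is the set of vertices adjacent to $x$ (containing $x$ iff $x$ has a loop), and the degree of $x$ is $|\Gamma(x)|$ (a loop contributes exactly 1). Common neighbours of $x,y$ are the elements of $\Gamma(x)\cap\Gamma(y)$. A $k$-regular graph on $v$ vertices is an LDDG with parameters $(v,k,\lambda_1,\lambda_2,m,n)$ if its vertex set can be partitioned into $m$ classes of size $n$ such that any two distinct vertices of the same class have exactly $\lambda_1$ common neighbours and any two vertices of different classes have exactly $\lambda_2$ common neighbours. It is proper if $m,n\geq 2$ and $\lambda_1\neq\lambda_2$. -}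

module Defs where

open import Data.Nat using (ℕ; _≤_; _≥_)
open import Data.Bool using (Bool; true)
open import Data.Fin using (Fin)
open import Data.Fin.Subset using (Subset; ∣_∣; _∩_)
open import Data.Vec using (tabulate)
open import Data.Product using (_×_)
open import Relation.Binary.PropositionalEquality using (_≡_; _≢_)
open import Relation.Nullary.Decidable using (⌊_⌋)
open import Data.Fin using (_≟_)

-- A finite undirected graph on vertex set Fin v, loops allowed, no multi-edges:
-- a symmetric Boolean adjacency relation (adj x x = true means a loop at x).
record Graph (v : ℕ) : Set where
  field
    adj      : Fin v → Fin v → Bool
    adj-symm : ∀ x y → adj x y ≡ adj y x

open Graph public

nbhd : ∀ {v} → Graph v → Fin v → Subset v
nbhd G x = tabulate (λ y → adj G x y)

-- degree = |Γ(x)| (a loop contributes exactly 1)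
degree : ∀ {v} → Graph v → Fin v → ℕ
degree G x = ∣ nbhd G x ∣

common : ∀ {v} → Graph v → Fin v → Fin v → ℕ
common G x y = ∣ nbhd G x ∩ nbhd G y ∣

Regular : ∀ {v} → Graph v → ℕ → Set
Regular G k = ∀ x → degree G x ≡ k

classOf : ∀ {v m} → (Fin v → Fin m) → Fin m → Subset v
classOf c i = tabulate (λ x → ⌊ c x ≟ i ⌋)

record IsLDDG {v : ℕ} (G : Graph v) (k λ₁ λ₂ m n : ℕ) : Set where
  field
    regular    : Regular G k
    cls        : Fin v → Fin m
    class-size : ∀ i → ∣ classOf cls i ∣ ≡ n
    same       : ∀ x y → x ≢ y → cls x ≡ cls y → common G x y ≡ λ₁
    different  : ∀ x y → cls x ≢ cls y → common G x y ≡ λ₂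

IsProperLDDG : ∀ {v} → Graph v → (k λ₁ λ₂ m n : ℕ) → Set
IsProperLDDG G k λ₁ λ₂ m n =
  IsLDDG G k λ₁ λ₂ m n × m ≥ 2 × n ≥ 2 × λ₁ ≢ λ₂

{-# OPTIONS --safe #-}
-- The common-neighbour matrix C is the Gram matrix A Aᵀ of the adjacency matrix, so
-- 2⟨s, C t⟩ ≤ ⟨s, C s⟩ + ⟨t, C t⟩ (AM-GM applied to Aᵀs and Aᵀt). For the indicator vectors
-- of two distinct classes this gives n²λ₂ ≤ n(k + (n - 1)λ₁). A row of C sums to k² by
-- regularity and to k + (n - 1)λ₁ + (v - n)λ₂ by the class structure; combining the two,
-- vλ₂ ≤ k².
module Submission where

open import Defs
open import Data.Nat using (ℕ; _≤_; _*_; _/_; NonZero)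
open import Data.Nat.Base using (zero; suc; _+_; z≤n; s≤s)
open import Data.Nat.Properties hiding (_≟_)
open import Data.Nat.DivMod using (m*n/n≡m; /-monoˡ-≤)
open import Data.Nat.Tactic.RingSolver using (solve; solve-∀)
open import Data.List.Base using (_∷_; [])
open import Data.Bool.Base using (Bool; true; false; _∧_)
open import Data.Fin.Base using (Fin; zero; suc)
open import Data.Fin.Properties using (_≟_; punchInᵢ≢i)
open import Data.Fin.Subset using (Subset; ∣_∣; _∩_)
open import Data.Fin.Subset.Properties using (∩-idem)
open import Data.Vec.Base as Vec using (lookup)
open import Data.Vec.Properties using (lookup∘tabulate; lookup-zipWith)
open import Data.Product.Base using (_,_)
open import Data.Sum.Base using ([_,_]′)
open import Algebra.Properties.CommutativeSemigroup +-commutativeSemigroup using () renaming (interchange to +-interchange)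
open import Relation.Binary.PropositionalEquality
open import Relation.Nullary.Decidable using (⌊_⌋; yes; no)
open import Relation.Nullary.Negation using (contradiction)
open import Algebra.Properties.Semiring.Sum +-*-semiring
  using (sum; sum-syntax; sum-cong-≗; ∑-distrib-+; ∑-comm; *-distribˡ-sum; *-distribʳ-sum)

open ≡-Reasoning

m*n+m*n≤m*m+n*n : ∀ m n → m * n + m * n ≤ m * m + n * n
m*n+m*n≤m*m+n*n m n =
  [ ordered
  , (λ n≤m → subst₂ _≤_ (cong₂ _+_ (*-comm n m) (*-comm n m)) (+-comm (n * n) (m * m)) (ordered n≤m))
  ]′ (≤-total m n)
  where
  gap : ∀ a d → a * (a + d) + a * (a + d) + d * d ≡ a * a + (a + d) * (a + d)
  gap = solve-∀
  ordered : ∀ {a b} → a ≤ b → a * b + a * b ≤ a * a + b * b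
  ordered {a} a≤b with m≤n⇒∃[o]m+o≡n a≤b
  ... | d , refl = subst (a * (a + d) + a * (a + d) ≤_) (gap a d) (m≤m+n _ (d * d))

m+m≤n+n⇒m≤n : ∀ {m n} → m + m ≤ n + n → m ≤ n
m+m≤n+n⇒m≤n m+m≤n+n = ≮⇒≥ (λ n<m → <⇒≱ (+-mono-< n<m n<m) m+m≤n+n)

average-≤ : ∀ {a b c d e} → a + a ≤ b + c → b + d ≡ e → c + d ≡ e → a + d ≤ e
average-≤ {a} {b} {c} {d} a+a≤b+c b+d≡e c+d≡e = m+m≤n+n⇒m≤n (subst₂ _≤_
  (+-interchange a a d d)
  (trans (+-interchange b c d d) (cong₂ _+_ b+d≡e c+d≡e))
  (+-monoˡ-≤ (d + d) a+a≤b+c))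

sum-mono-≤ : ∀ {v} {f g : Fin v → ℕ} → (∀ x → f x ≤ g x) → sum f ≤ sum g
sum-mono-≤ {zero}  f≤g = z≤n
sum-mono-≤ {suc v} f≤g = +-mono-≤ (f≤g zero) (sum-mono-≤ (λ x → f≤g (suc x)))

∑-distrib-+₃ : ∀ {v} (f g h : Fin v → ℕ) →
  ∑[ x < v ] (f x + g x + h x) ≡ ∑[ x < v ] f x + ∑[ x < v ] g x + ∑[ x < v ] h x
∑-distrib-+₃ f g h = trans (∑-distrib-+ (λ x → f x + g x) h) (cong (_+ sum h) (∑-distrib-+ f g))

sum-const : ∀ v c → ∑[ x < v ] c ≡ v * c
sum-const zero    c = refl
sum-const (suc v) c = cong (c +_) (sum-const v c)

𝟙 : Bool → ℕ
𝟙 true  = 1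
𝟙 false = 0

𝟙-∧ : ∀ a b → 𝟙 (a ∧ b) ≡ 𝟙 a * 𝟙 b
𝟙-∧ true  b = sym (+-identityʳ (𝟙 b))
𝟙-∧ false b = refl

∣p∣≡∑𝟙 : ∀ {v} (p : Subset v) → ∣ p ∣ ≡ ∑[ x < v ] 𝟙 (lookup p x)
∣p∣≡∑𝟙 Vec.[]          = refl
∣p∣≡∑𝟙 (true  Vec.∷ p) = cong suc (∣p∣≡∑𝟙 p)
∣p∣≡∑𝟙 (false Vec.∷ p) = ∣p∣≡∑𝟙 p

δ : ∀ {v} → Fin v → Fin v → ℕ
δ x y = 𝟙 ⌊ x ≟ y ⌋

∑-δ-* : ∀ {v} (x : Fin v) c → ∑[ y < v ] (δ x y * c) ≡ c
∑-δ-* {suc v} zero    c = begin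
  1 * c + ∑[ y < v ] (0 * c) ≡⟨ cong₂ _+_ (*-identityˡ c) (sum-const v 0) ⟩
  c + v * 0                  ≡⟨ cong (c +_) (*-zeroʳ v) ⟩
  c + 0                      ≡⟨ +-identityʳ c ⟩
  c                          ∎
∑-δ-* {suc v} (suc x) c = trans (sum-cong-≗ shift) (∑-δ-* x c)
  where
  shift : ∀ y → δ (suc x) (suc y) * c ≡ δ x y * c
  shift y with x ≟ y
  ... | yes _ = refl
  ... | no  _ = refl

⟨_,_⟩ : ∀ {w} → (Fin w → ℕ) → (Fin w → ℕ) → ℕ
⟨_,_⟩ {w} s t = ∑[ z < w ] (s z * t z)

infix  30 _ᵀ
infixr 25 _·_

_ᵀ : ∀ {v w} → (Fin v → Fin w → ℕ) → Fin w → Fin v → ℕ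
(A ᵀ) z x = A x z

_·_ : ∀ {v w} → (Fin v → Fin w → ℕ) → (Fin w → ℕ) → Fin v → ℕ
(A · t) x = ⟨ A x , t ⟩

gram : ∀ {v w} → (Fin v → Fin w → ℕ) → Fin v → Fin v → ℕ
gram A x y = ⟨ A x , A y ⟩

module _ {v w : ℕ} where

  ·-adjoint : ∀ s (A : Fin v → Fin w → ℕ) t → ⟨ s , A · t ⟩ ≡ ⟨ A ᵀ · s , t ⟩
  ·-adjoint s A t = begin
    ∑[ x < v ] (s x * ∑[ z < w ] (A x z * t z))   ≡⟨ sum-cong-≗ (λ x → *-distribˡ-sum (s x) (λ z → A x z * t z)) ⟩
    ∑[ x < v ] ∑[ z < w ] (s x * (A x z * t z))   ≡⟨ ∑-comm (λ x z → s x * (A x z * t z)) ⟩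
    ∑[ z < w ] ∑[ x < v ] (s x * (A x z * t z))   ≡⟨ sum-cong-≗ (λ z → sum-cong-≗ (λ x → reassoc (s x) (A x z) (t z))) ⟩
    ∑[ z < w ] ∑[ x < v ] (A x z * s x * t z)     ≡⟨ sum-cong-≗ (λ z → *-distribʳ-sum (t z) (λ x → A x z * s x)) ⟨
    ∑[ z < w ] (∑[ x < v ] (A x z * s x) * t z)   ∎
    where
    reassoc : ∀ a b c → a * (b * c) ≡ b * a * c
    reassoc a b c = trans (sym (*-assoc a b c)) (cong (_* c) (*-comm a b))

  ∑-gram-row : ∀ (A : Fin v → Fin w → ℕ) {c} → (∀ z → ∑[ y < v ] A y z ≡ c) →
               ∀ x → ∑[ y < v ] gram A x y ≡ ∑[ z < w ] A x z * c
  ∑-gram-row A {c} colSum x = begin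
    ∑[ y < v ] ∑[ z < w ] (A x z * A y z)   ≡⟨ ∑-comm (λ y z → A x z * A y z) ⟩
    ∑[ z < w ] ∑[ y < v ] (A x z * A y z)   ≡⟨ sum-cong-≗ (λ z → *-distribˡ-sum (A x z) (λ y → A y z)) ⟨
    ∑[ z < w ] (A x z * ∑[ y < v ] A y z)   ≡⟨ sum-cong-≗ (λ z → cong (A x z *_) (colSum z)) ⟩
    ∑[ z < w ] (A x z * c)                  ≡⟨ *-distribʳ-sum c (A x) ⟨
    ∑[ z < w ] A x z * c                    ∎

⟨,⟩-comm : ∀ {w} (s t : Fin w → ℕ) → ⟨ s , t ⟩ ≡ ⟨ t , s ⟩
⟨,⟩-comm s t = sum-cong-≗ (λ z → *-comm (s z) (t z))

⟨s,t⟩+⟨s,t⟩≤⟨s,s⟩+⟨t,t⟩ : ∀ {w} (s t : Fin w → ℕ) → ⟨ s , t ⟩ + ⟨ s , t ⟩ ≤ ⟨ s , s ⟩ + ⟨ t , t ⟩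
⟨s,t⟩+⟨s,t⟩≤⟨s,s⟩+⟨t,t⟩ s t = subst₂ _≤_
  (∑-distrib-+ (λ z → s z * t z) (λ z → s z * t z))
  (∑-distrib-+ (λ z → s z * s z) (λ z → t z * t z))
  (sum-mono-≤ (λ z → m*n+m*n≤m*m+n*n (s z) (t z)))

module _ {v w : ℕ} (A : Fin v → Fin w → ℕ) where

  gram-·-assoc : ∀ t x → (gram A · t) x ≡ (A · (A ᵀ · t)) x
  gram-·-assoc t x = begin
    ∑[ y < v ] (⟨ A x , A y ⟩ * t y)   ≡⟨ sum-cong-≗ (λ y → cong (_* t y) (⟨,⟩-comm (A x) (A y))) ⟩
    ∑[ y < v ] (⟨ A y , A x ⟩ * t y)   ≡⟨ ·-adjoint (A x) (A ᵀ) t ⟨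
    ⟨ A x , A ᵀ · t ⟩                  ∎

  gram-form : ∀ s t → ⟨ s , gram A · t ⟩ ≡ ⟨ A ᵀ · s , A ᵀ · t ⟩
  gram-form s t = trans (sum-cong-≗ (λ x → cong (s x *_) (gram-·-assoc t x))) (·-adjoint s A (A ᵀ · t))

  gram-semidefinite : ∀ s t → ⟨ s , gram A · t ⟩ + ⟨ s , gram A · t ⟩ ≤ ⟨ s , gram A · s ⟩ + ⟨ t , gram A · t ⟩
  gram-semidefinite s t = subst₂ _≤_
    (sym (cong₂ _+_ (gram-form s t) (gram-form s t)))
    (sym (cong₂ _+_ (gram-form s s) (gram-form t t)))
    (⟨s,t⟩+⟨s,t⟩≤⟨s,s⟩+⟨t,t⟩ (A ᵀ · s) (A ᵀ · t))

module _ {v : ℕ} (G : Graph v) where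

  adjacency : Fin v → Fin v → ℕ
  adjacency x y = 𝟙 (adj G x y)

  lookup-nbhd : ∀ x y → lookup (nbhd G x) y ≡ adj G x y
  lookup-nbhd x = lookup∘tabulate (adj G x)

  degree≡∑adjacency : ∀ x → degree G x ≡ ∑[ y < v ] adjacency x y
  degree≡∑adjacency x = trans (∣p∣≡∑𝟙 (nbhd G x)) (sum-cong-≗ (λ y → cong 𝟙 (lookup-nbhd x y)))

  common≡gram : ∀ x y → common G x y ≡ gram adjacency x y
  common≡gram x y = trans (∣p∣≡∑𝟙 (nbhd G x ∩ nbhd G y)) (sum-cong-≗ (λ z → begin
    𝟙 (lookup (nbhd G x ∩ nbhd G y) z)                   ≡⟨ cong 𝟙 (lookup-zipWith _∧_ z (nbhd G x) (nbhd G y)) ⟩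
    𝟙 (lookup (nbhd G x) z ∧ lookup (nbhd G y) z)        ≡⟨ 𝟙-∧ (lookup (nbhd G x) z) (lookup (nbhd G y) z) ⟩
    𝟙 (lookup (nbhd G x) z) * 𝟙 (lookup (nbhd G y) z)    ≡⟨ cong₂ (λ a b → 𝟙 a * 𝟙 b) (lookup-nbhd x z) (lookup-nbhd y z) ⟩
    adjacency x z * adjacency y z                         ∎))

  common-self≡degree : ∀ x → common G x x ≡ degree G x
  common-self≡degree x = cong ∣_∣ (∩-idem (nbhd G x))

  common-semidefinite : ∀ s t →
    ⟨ s , common G · t ⟩ + ⟨ s , common G · t ⟩ ≤ ⟨ s , common G · s ⟩ + ⟨ t , common G · t ⟩
  common-semidefinite s t = subst₂ _≤_
    (cong₂ _+_ (gram≡common s t) (gram≡common s t))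
    (cong₂ _+_ (gram≡common s s) (gram≡common t t))
    (gram-semidefinite adjacency s t)
    where
    gram≡common : ∀ s t → ⟨ s , gram adjacency · t ⟩ ≡ ⟨ s , common G · t ⟩
    gram≡common s t = sum-cong-≗ (λ x → cong (s x *_)
      (sum-cong-≗ (λ y → cong (_* t y) (sym (common≡gram x y)))))

  ∑-common-row : ∀ {k} → Regular G k → ∀ x → ∑[ y < v ] common G x y ≡ k * k
  ∑-common-row {k} regular x = begin
    ∑[ y < v ] common G x y           ≡⟨ sum-cong-≗ (common≡gram x) ⟩
    ∑[ y < v ] gram adjacency x y     ≡⟨ ∑-gram-row adjacency column-sum x ⟩
    ∑[ y < v ] adjacency x y * k      ≡⟨ cong (_* k) (trans (sym (degree≡∑adjacency x)) (regular x)) ⟩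
    k * k                             ∎
    where
    column-sum : ∀ z → ∑[ y < v ] adjacency y z ≡ k
    column-sum z = begin
      ∑[ y < v ] adjacency y z   ≡⟨ sum-cong-≗ (λ y → cong 𝟙 (adj-symm G y z)) ⟩
      ∑[ y < v ] adjacency z y   ≡⟨ degree≡∑adjacency z ⟨
      degree G z                 ≡⟨ regular z ⟩
      k                          ∎

module _ {v : ℕ} {G : Graph v} {k λ₁ λ₂ m n : ℕ} (L : IsLDDG G k λ₁ λ₂ m n) where
  open IsLDDG L

  member : Fin m → Fin v → ℕ
  member i y = 𝟙 ⌊ cls y ≟ i ⌋

  ∑-member : ∀ i → ∑[ y < v ] member i y ≡ n
  ∑-member i = begin
    ∑[ y < v ] member i y   ≡⟨ sum-cong-≗ (λ y → cong 𝟙 (lookup∘tabulate (λ x → ⌊ cls x ≟ i ⌋) y)) ⟨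
    ∑[ y < v ] 𝟙 (lookup (classOf cls i) y) ≡⟨ ∣p∣≡∑𝟙 (classOf cls i) ⟨
    ∣ classOf cls i ∣        ≡⟨ class-size i ⟩
    n                       ∎

  ⟨member,f⟩≡n*c : ∀ i (f : Fin v → ℕ) {c} → (∀ {y} → cls y ≡ i → f y ≡ c) → ⟨ member i , f ⟩ ≡ n * c
  ⟨member,f⟩≡n*c i f {c} f≡c = begin
    ∑[ y < v ] (member i y * f y)   ≡⟨ sum-cong-≗ restrict ⟩
    ∑[ y < v ] (member i y * c)     ≡⟨ *-distribʳ-sum c (member i) ⟨
    ∑[ y < v ] member i y * c       ≡⟨ cong (_* c) (∑-member i) ⟩
    n * c                           ∎
    where
    restrict : ∀ y → member i y * f y ≡ member i y * c
    restrict y with cls y ≟ i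
    ... | yes p = cong (1 *_) (f≡c p)
    ... | no  _ = refl

  ∑-member-* : ∀ i c → ∑[ y < v ] (member i y * c) ≡ n * c
  ∑-member-* i c = ⟨member,f⟩≡n*c i (λ _ → c) (λ _ → refl)

  ⟨member,common⟩-own-class : ∀ {x i} → cls x ≡ i → ⟨ member i , common G x ⟩ + λ₁ ≡ k + n * λ₁
  ⟨member,common⟩-own-class {x} {i} p = begin
    ⟨ member i , C ⟩ + λ₁
      ≡⟨ cong (⟨ member i , C ⟩ +_) (∑-δ-* x λ₁) ⟨
    ⟨ member i , C ⟩ + ∑[ y < v ] (δ x y * λ₁)
      ≡⟨ ∑-distrib-+ (λ y → member i y * C y) (λ y → δ x y * λ₁) ⟨
    ∑[ y < v ] (member i y * C y + δ x y * λ₁)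
      ≡⟨ sum-cong-≗ pointwise ⟩
    ∑[ y < v ] (δ x y * k + member i y * λ₁)
      ≡⟨ ∑-distrib-+ (λ y → δ x y * k) (λ y → member i y * λ₁) ⟩
    ∑[ y < v ] (δ x y * k) + ∑[ y < v ] (member i y * λ₁)
      ≡⟨ cong₂ _+_ (∑-δ-* x k) (∑-member-* i λ₁) ⟩
    k + n * λ₁
      ∎
    where
    C = common G x
    pointwise : ∀ y → member i y * C y + δ x y * λ₁ ≡ δ x y * k + member i y * λ₁
    pointwise y with x ≟ y | cls y ≟ i
    ... | yes refl | yes _ rewrite common-self≡degree G x | regular x = refl
    ... | yes refl | no  q = contradiction p q
    ... | no  x≢y  | yes q rewrite same x y x≢y (trans p (sym q)) = +-identityʳ (λ₁ + 0)
    ... | no  _    | no  _ = refl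

  ⟨member,common⟩-other-class : ∀ {x j} → cls x ≢ j → ⟨ member j , common G x ⟩ ≡ n * λ₂
  ⟨member,common⟩-other-class {x} {j} x∉j =
    ⟨member,f⟩≡n*c j (common G x) (λ {y} q → different x y (λ r → x∉j (trans r q)))

  -- The row sum k + (n ∸ 1) * λ₁ + (v ∸ n) * λ₂, with the subtractions moved across.
  ∑-common-row-by-classes : ∀ x → ∑[ y < v ] common G x y + λ₁ + n * λ₂ ≡ k + n * λ₁ + v * λ₂
  ∑-common-row-by-classes x = begin
    ∑[ y < v ] C y + λ₁ + n * λ₂
      ≡⟨ cong₂ _+_ (cong (∑[ y < v ] C y +_) (∑-δ-* x λ₁)) (∑-member-* i λ₂) ⟨
    ∑[ y < v ] C y + ∑[ y < v ] (δ x y * λ₁) + ∑[ y < v ] (member i y * λ₂)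
      ≡⟨ ∑-distrib-+₃ C (λ y → δ x y * λ₁) (λ y → member i y * λ₂) ⟨
    ∑[ y < v ] (C y + δ x y * λ₁ + member i y * λ₂)
      ≡⟨ sum-cong-≗ pointwise ⟩
    ∑[ y < v ] (δ x y * k + member i y * λ₁ + λ₂)
      ≡⟨ ∑-distrib-+₃ (λ y → δ x y * k) (λ y → member i y * λ₁) (λ _ → λ₂) ⟩
    ∑[ y < v ] (δ x y * k) + ∑[ y < v ] (member i y * λ₁) + ∑[ y < v ] λ₂
      ≡⟨ cong₂ _+_ (cong₂ _+_ (∑-δ-* x k) (∑-member-* i λ₁)) (sum-const v λ₂) ⟩
    k + n * λ₁ + v * λ₂
      ∎
    where
    i = cls x
    C = common G x
    pointwise : ∀ y → C y + δ x y * λ₁ + member i y * λ₂ ≡ δ x y * k + member i y * λ₁ + λ₂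
    pointwise y with x ≟ y | cls y ≟ i
    ... | yes refl | yes _ rewrite common-self≡degree G x | regular x = solve (k ∷ λ₁ ∷ λ₂ ∷ [])
    ... | yes refl | no  q = contradiction refl q
    ... | no  x≢y  | yes q rewrite same x y x≢y (sym q) = solve (λ₁ ∷ λ₂ ∷ [])
    ... | no  _    | no  q rewrite different x y (λ r → q (sym r)) = solve (λ₂ ∷ [])

  form-same-class : ∀ i → ⟨ member i , common G · member i ⟩ + n * λ₁ ≡ n * (k + n * λ₁)
  form-same-class i = begin
    ⟨ member i , F ⟩ + n * λ₁
      ≡⟨ cong (⟨ member i , F ⟩ +_) (∑-member-* i λ₁) ⟨
    ⟨ member i , F ⟩ + ∑[ x < v ] (member i x * λ₁)
      ≡⟨ ∑-distrib-+ (λ x → member i x * F x) (λ x → member i x * λ₁) ⟨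
    ∑[ x < v ] (member i x * F x + member i x * λ₁)
      ≡⟨ sum-cong-≗ (λ x → *-distribˡ-+ (member i x) (F x) λ₁) ⟨
    ⟨ member i , (λ x → F x + λ₁) ⟩
      ≡⟨ ⟨member,f⟩≡n*c i (λ x → F x + λ₁) own-row ⟩
    n * (k + n * λ₁)
      ∎
    where
    F = common G · member i
    own-row : ∀ {x} → cls x ≡ i → F x + λ₁ ≡ k + n * λ₁
    own-row {x} p = trans (cong (_+ λ₁) (⟨,⟩-comm (common G x) (member i))) (⟨member,common⟩-own-class p)

  form-distinct-classes : ∀ {i j} → j ≢ i → ⟨ member i , common G · member j ⟩ ≡ n * (n * λ₂)
  form-distinct-classes {i} {j} j≢i = ⟨member,f⟩≡n*c i (common G · member j) (λ {x} p →
    trans (⟨,⟩-comm (common G x) (member j)) (⟨member,common⟩-other-class (λ q → j≢i (trans (sym q) p))))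

  n*λ₂+λ₁≤k+n*λ₁ : .{{_ : NonZero n}} → ∀ {i j} → j ≢ i → n * λ₂ + λ₁ ≤ k + n * λ₁
  n*λ₂+λ₁≤k+n*λ₁ {i} {j} j≢i = *-cancelˡ-≤ n (subst (_≤ n * (k + n * λ₁))
    (sym (*-distribˡ-+ n (n * λ₂) λ₁))
    (average-≤ {b = Qᵢᵢ} {c = Qⱼⱼ} Qᵢⱼ+Qᵢⱼ≤Qᵢᵢ+Qⱼⱼ (form-same-class i) (form-same-class j)))
    where
    Qᵢᵢ = ⟨ member i , common G · member i ⟩
    Qⱼⱼ = ⟨ member j , common G · member j ⟩
    Qᵢⱼ+Qᵢⱼ≤Qᵢᵢ+Qⱼⱼ : n * (n * λ₂) + n * (n * λ₂) ≤ Qᵢᵢ + Qⱼⱼ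
    Qᵢⱼ+Qᵢⱼ≤Qᵢᵢ+Qⱼⱼ = subst (λ q → q + q ≤ Qᵢᵢ + Qⱼⱼ) (form-distinct-classes j≢i)
      (common-semidefinite G (member i) (member j))

  v*λ₂≤k*k : .{{_ : NonZero n}} → ∀ x {j} → j ≢ cls x → v * λ₂ ≤ k * k
  v*λ₂≤k*k x j≢i = +-cancelˡ-≤ (n * λ₂ + λ₁) (v * λ₂) (k * k)
    (subst (n * λ₂ + λ₁ + v * λ₂ ≤_) row (+-monoˡ-≤ (v * λ₂) (n*λ₂+λ₁≤k+n*λ₁ j≢i)))
    where
    row : k + n * λ₁ + v * λ₂ ≡ n * λ₂ + λ₁ + k * k
    row = begin
      k + n * λ₁ + v * λ₂                   ≡⟨ ∑-common-row-by-classes x ⟨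
      ∑[ y < v ] common G x y + λ₁ + n * λ₂ ≡⟨ cong (λ s → s + λ₁ + n * λ₂) (∑-common-row G regular x) ⟩
      k * k + λ₁ + n * λ₂                   ≡⟨ solve (k ∷ λ₁ ∷ n ∷ λ₂ ∷ []) ⟩
      n * λ₂ + λ₁ + k * k                   ∎

proposition3p18 : (v k λ₁ λ₂ m n : ℕ) .{{_ : NonZero v}} (G : Graph v) →
    IsProperLDDG G k λ₁ λ₂ m n → λ₂ ≤ (k * k) / v
proposition3p18 (suc v) k λ₁ λ₂ (suc (suc m)) (suc n) G (L , s≤s (s≤s _) , s≤s _ , _) =
  subst (_≤ (k * k) / suc v) (m*n/n≡m λ₂ (suc v))
    (/-monoˡ-≤ (suc v) (subst (_≤ k * k) (*-comm (suc v) λ₂) (v*λ₂≤k*k L zero (punchInᵢ≢i _ zero))))
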